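{- Let $n\ge1$. For every $0\le k<3^{n-1}$, $C_n(k)=C_{n-1}(k)$ and $C_n(2\cdot 3^{n-1}+k)=C_{n-1}(k)$; that is, the first third and the last third of the list $C_n$ are copies of $C_{n-1}$.
   Context: The unit weight-$3$ Stern–Brocot sequences $SB_n$ ($n\ge0$): $SB_0=(\frac{0}{1},\frac{1}{1})$, and $SB_{n+1}$ is obtained from $SB_n$ by keeping all its terms in order and inserting, between each pair of consecutive terms $\frac{p}{q},\frac{r}{s}$ (in lowest terms, positive denominators), the two fractions $\frac{2p+r}{2q+s}$ and $\frac{p+2r}{q+2s}$, each reduced to lowest terms, in this order. $SB_n$ has $3^n+1$ terms, indexed from $0$. For $0\le i<3^n$, $C_n(i)=qr-ps$ where $\frac{p}{q}$ and $\frac{r}{s}$ are the $i$-th and $(i+1)$-th terms of $SB_n$ in lowest terms with positive denominators; $C_n=(C_n(0),\dots,C_n(3^n-1))$. -}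

module Defs where

open import Data.Nat using (ℕ; zero; suc; _+_; _*_)
open import Data.Nat.DivMod using (_/_)
open import Data.Nat.GCD using (gcd)
open import Data.Integer using (ℤ; +_) renaming (_*_ to _*ℤ_; _-_ to _-ℤ_)
open import Data.List using (List; []; _∷_)
open import Data.Maybe using (Maybe; just; nothing)
open import Data.Product using (_×_; _,_)

-- A fraction p/q is represented by the pair (p , q) of naturals
-- (all terms of SB_n lie in [0,1], so numerators are nonnegative).
Frac : Set
Frac = ℕ × ℕ

-- division by g, with the convention x / 0 = x (never used: denominators are positive)
divBy : ℕ → ℕ → ℕ
divBy a zero    = a
divBy a (suc g) = a / suc g

reduce : Frac → Frac
reduce (a , b) = divBy a (gcd a b) , divBy b (gcd a b)

left right : Frac → Frac → Frac
left  (p , q) (r , s) = reduce (2 * p + r , 2 * q + s)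
right (p , q) (r , s) = reduce (p + 2 * r , q + 2 * s)

refine : List Frac → List Frac
refine []                 = []
refine (x ∷ [])           = x ∷ []
refine (x ∷ ys@(y ∷ _)) = x ∷ left x y ∷ right x y ∷ refine ys

SB : ℕ → List Frac
SB zero    = (0 , 1) ∷ (1 , 1) ∷ []
SB (suc n) = refine (SB n)

det : Frac → Frac → ℤ
det (p , q) (r , s) = (+ q *ℤ + r) -ℤ (+ p *ℤ + s)

dets : List Frac → List ℤ
dets []                 = []
dets (x ∷ [])           = []
dets (x ∷ ys@(y ∷ _)) = det x y ∷ dets ys

C : ℕ → List ℤ
C n = dets (SB n)

at : {A : Set} → List A → ℕ → Maybe A
at []       _       = nothing
at (x ∷ _)  zero    = just x
at (_ ∷ xs) (suc i) = at xs i

{-# OPTIONS --safe #-}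
module Submission where

-- The Möbius maps x ↦ x/(2x+1) and x ↦ (2−x)/(3−2x), with unimodular matrices [[1,0],[2,1]]
-- and [[−1,2],[−2,3]], send [0,1] onto [0,1/3] and onto [2/3,1]. Acting linearly on
-- numerator–denominator vectors they preserve gcds, so they commute with reduction to lowest
-- terms and hence with the two weighted mediants used by the refinement; being unimodular
-- they also preserve qr − ps. Since refinement is local, C_{n+1} is the concatenation of the
-- determinant lists of the n-fold refinements of [0,1/3], [1/3,2/3] and [2/3,1], and the first
-- and last of these are the images of SB_n under the two maps.

open import Defs
open import Data.Nat using (ℕ; zero; suc; _+_; _*_; _∸_; _^_; _<_; _≤_; _≟_; s≤s; z≤n)
open import Data.Nat.Properties
open import Data.Nat.DivMod using (_/_; m*n/n≡m; /-monoˡ-≤)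
open import Data.Nat.GCD
  using (gcd; gcd[m,n]∣m; gcd[m,n]∣n; gcd[m,n]≡0⇒m≡0; gcd[m,n]≡0⇒n≡0; gcd-comm; gcd-GCD; module GCD)
open import Data.Nat.Divisibility using (divides)
open import Data.Nat.Tactic.RingSolver using (solve-∀)
open import Data.Integer using (ℤ; +_; _⊖_) renaming (_*_ to _*ℤ_; _-_ to _-ℤ_)
import Data.Integer.Properties as ℤ
open import Data.List using (List; []; _∷_; _++_; length; map)
open import Data.List.Relation.Unary.All using (All; []; _∷_)
open import Data.List.Properties using (++-assoc; length-++)
open import Data.Product using (_×_; _,_; ∃-syntax)
open import Function using (_∘_)
open import Relation.Nullary using (yes; no; contradiction)
open import Relation.Binary.PropositionalEquality
open ≡-Reasoning

infixl 6 _⊕_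
infixr 7 _⊙_

_⊕_ : Frac → Frac → Frac
(p , q) ⊕ (r , s) = p + r , q + s

_⊙_ : ℕ → Frac → Frac
g ⊙ (p , q) = g * p , g * q

content : Frac → ℕ
content (p , q) = gcd p q

AtMostOne : Frac → Set
AtMostOne (p , q) = p ≤ q

⊕-AtMostOne : ∀ {x y} → AtMostOne x → AtMostOne y → AtMostOne (x ⊕ y)
⊕-AtMostOne = +-mono-≤

⊙-AtMostOne : ∀ g {x} → AtMostOne x → AtMostOne (g ⊙ x)
⊙-AtMostOne g = *-monoʳ-≤ g

reduce-AtMostOne : ∀ {x} → AtMostOne x → AtMostOne (reduce x)
reduce-AtMostOne {p , q} p≤q with gcd p q
... | zero  = p≤q
... | suc g = /-monoˡ-≤ (suc g) p≤q

content⊙reduce : ∀ x → content x ⊙ reduce x ≡ x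
content⊙reduce (p , q) with gcd p q | gcd[m,n]∣m p q | gcd[m,n]∣n p q | gcd[m,n]≡0⇒m≡0 {p} {q} | gcd[m,n]≡0⇒n≡0 p {q}
... | zero  | _ | _ | p≡0 | q≡0 = sym (cong₂ _,_ (p≡0 refl) (q≡0 refl))
... | suc g | divides a p≡a*g | divides b q≡b*g | _ | _ =
  cong₂ _,_ (cancel {p} {a} p≡a*g) (cancel {q} {b} q≡b*g)
  where
  cancel : ∀ {n m} → n ≡ m * suc g → suc g * (n / suc g) ≡ n
  cancel {n} {m} n≡m*g = begin
    suc g * (n / suc g)         ≡⟨ cong (λ k → suc g * (k / suc g)) n≡m*g ⟩
    suc g * (m * suc g / suc g) ≡⟨ cong (suc g *_) (m*n/n≡m m (suc g)) ⟩
    suc g * m                   ≡⟨ *-comm (suc g) m ⟩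
    m * suc g                   ≡⟨ n≡m*g ⟨
    n                           ∎

reduce-⊙ : ∀ {g} x → g ≢ 0 → content (g ⊙ x) ≡ g → reduce (g ⊙ x) ≡ x
reduce-⊙ {zero}  _       g≢0 _ = contradiction refl g≢0
reduce-⊙ {suc g} (p , q) _ c≡g rewrite c≡g = cong₂ _,_ (cancel p) (cancel q)
  where
  cancel : ∀ n → suc g * n / suc g ≡ n
  cancel n = trans (cong (_/ suc g) (*-comm (suc g) n)) (m*n/n≡m n (suc g))

refine^ : ℕ → List Frac → List Frac
refine^ zero    xs = xs
refine^ (suc n) xs = refine^ n (refine xs)

Cfrom : ℕ → Frac → Frac → List ℤ
Cfrom n a b = dets (refine^ n (a ∷ b ∷ []))

refine-AtMostOne : ∀ {xs} → All AtMostOne xs → All AtMostOne (refine xs)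
refine-AtMostOne []                 = []
refine-AtMostOne (x≤1 ∷ [])         = x≤1 ∷ []
refine-AtMostOne (x≤1 ∷ y≤1 ∷ ys≤1) =
  x≤1 ∷ reduce-AtMostOne (⊕-AtMostOne (⊙-AtMostOne 2 x≤1) y≤1)
      ∷ reduce-AtMostOne (⊕-AtMostOne x≤1 (⊙-AtMostOne 2 y≤1))
      ∷ refine-AtMostOne (y≤1 ∷ ys≤1)

refine^-AtMostOne : ∀ n {xs} → All AtMostOne xs → All AtMostOne (refine^ n xs)
refine^-AtMostOne zero    xs≤1 = xs≤1
refine^-AtMostOne (suc n) xs≤1 = refine^-AtMostOne n (refine-AtMostOne xs≤1)

refine-∷ : ∀ b xs → ∃[ ys ] refine (b ∷ xs) ≡ b ∷ ys
refine-∷ b []      = [] , refl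
refine-∷ b (_ ∷ _) = _ , refl

dets-refine^-∷∷ : ∀ n a b xs → dets (refine^ n (a ∷ b ∷ xs)) ≡ Cfrom n a b ++ dets (refine^ n (b ∷ xs))
Cfrom-suc : ∀ n a b → Cfrom (suc n) a b ≡
            Cfrom n a (left a b) ++ Cfrom n (left a b) (right a b) ++ Cfrom n (right a b) b

dets-refine^-∷∷ zero    a b xs = refl
dets-refine^-∷∷ (suc n) a b xs with refine-∷ b xs
... | ys , refine[b∷xs]≡b∷ys = begin
  dets (refine^ n (a ∷ l ∷ r ∷ refine (b ∷ xs)))
    ≡⟨ cong (λ zs → dets (refine^ n (a ∷ l ∷ r ∷ zs))) refine[b∷xs]≡b∷ys ⟩
  dets (refine^ n (a ∷ l ∷ r ∷ b ∷ ys))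
    ≡⟨ dets-refine^-∷∷ n a l (r ∷ b ∷ ys) ⟩
  A ++ dets (refine^ n (l ∷ r ∷ b ∷ ys))
    ≡⟨ cong (A ++_) (dets-refine^-∷∷ n l r (b ∷ ys)) ⟩
  A ++ B ++ dets (refine^ n (r ∷ b ∷ ys))
    ≡⟨ cong (λ zs → A ++ B ++ zs) (dets-refine^-∷∷ n r b ys) ⟩
  A ++ B ++ E ++ rest
    ≡⟨ cong (A ++_) (++-assoc B E rest) ⟨
  A ++ (B ++ E) ++ rest
    ≡⟨ ++-assoc A (B ++ E) rest ⟨
  (A ++ B ++ E) ++ rest
    ≡⟨ cong (_++ rest) (Cfrom-suc n a b) ⟨
  Cfrom (suc n) a b ++ rest
    ≡⟨ cong (λ zs → Cfrom (suc n) a b ++ dets (refine^ n zs)) refine[b∷xs]≡b∷ys ⟨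
  Cfrom (suc n) a b ++ dets (refine^ (suc n) (b ∷ xs))
    ∎
  where
  l = left a b
  r = right a b
  A = Cfrom n a l
  B = Cfrom n l r
  E = Cfrom n r b
  rest = dets (refine^ n (b ∷ ys))

Cfrom-suc n a b = begin
  dets (refine^ n (a ∷ l ∷ r ∷ b ∷ []))
    ≡⟨ dets-refine^-∷∷ n a l (r ∷ b ∷ []) ⟩
  Cfrom n a l ++ dets (refine^ n (l ∷ r ∷ b ∷ []))
    ≡⟨ cong (Cfrom n a l ++_) (dets-refine^-∷∷ n l r (b ∷ [])) ⟩
  Cfrom n a l ++ Cfrom n l r ++ Cfrom n r b
    ∎
  where
  l = left a b
  r = right a b

length-Cfrom : ∀ n a b → length (Cfrom n a b) ≡ 3 ^ n
length-Cfrom zero    a b = refl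
length-Cfrom (suc n) a b = begin
  length (Cfrom (suc n) a b)                   ≡⟨ cong length (Cfrom-suc n a b) ⟩
  length (A ++ B ++ E)                         ≡⟨ length-++ A ⟩
  length A + length (B ++ E)                   ≡⟨ cong (λ m → length A + m) (length-++ B) ⟩
  length A + (length B + length E)             ≡⟨ cong₂ _+_ (length-Cfrom n _ _) (cong₂ _+_ (length-Cfrom n _ _) (length-Cfrom n _ _)) ⟩
  3 ^ n + (3 ^ n + 3 ^ n)                      ≡⟨ lemma (3 ^ n) ⟩
  3 ^ suc n                                    ∎
  where
  A = Cfrom n a (left a b)
  B = Cfrom n (left a b) (right a b)
  E = Cfrom n (right a b) b
  lemma : ∀ m → m + (m + m) ≡ 3 * m
  lemma = solve-∀

refine^-suc : ∀ n xs → refine^ (suc n) xs ≡ refine (refine^ n xs)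
refine^-suc zero    xs = refl
refine^-suc (suc n) xs = refine^-suc n (refine xs)

C≡Cfrom : ∀ n → C n ≡ Cfrom n (0 , 1) (1 , 1)
C≡Cfrom n = cong dets (SB≡refine^ n)
  where
  SB≡refine^ : ∀ n → SB n ≡ refine^ n (SB 0)
  SB≡refine^ zero    = refl
  SB≡refine^ (suc n) = trans (cong refine (SB≡refine^ n)) (sym (refine^-suc n (SB 0)))

at-++ˡ : ∀ {A : Set} (xs : List A) {ys k} → k < length xs → at (xs ++ ys) k ≡ at xs k
at-++ˡ (x ∷ xs) {k = zero}  _         = refl
at-++ˡ (x ∷ xs) {k = suc k} (s≤s k<n) = at-++ˡ xs k<n

at-++ʳ : ∀ {A : Set} (xs : List A) {ys k} → at (xs ++ ys) (length xs + k) ≡ at ys k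
at-++ʳ []       = refl
at-++ʳ (x ∷ xs) = at-++ʳ xs

module Equivariance
  (f : Frac → Frac)
  (f-⊙ : ∀ g x → f (g ⊙ x) ≡ g ⊙ f x)
  (f-⊕ : ∀ {x y} → AtMostOne x → AtMostOne y → f (x ⊕ y) ≡ f x ⊕ f y)
  (f-content : ∀ {x} → AtMostOne x → content (f x) ≡ content x)
  (f-det : ∀ {x y} → AtMostOne x → AtMostOne y → det (f x) (f y) ≡ det x y)
  where

  reduce-f : ∀ {x} → AtMostOne x → reduce (f x) ≡ f (reduce x)
  reduce-f {x} x≤1 with content x ≟ 0
  ... | no c≢0 = begin
    reduce (f x)                   ≡⟨ cong (reduce ∘ f) (content⊙reduce x) ⟨
    reduce (f (c ⊙ reduce x))      ≡⟨ cong reduce (f-⊙ c (reduce x)) ⟩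
    reduce (c ⊙ f (reduce x))      ≡⟨ reduce-⊙ (f (reduce x)) c≢0 content≡c ⟩
    f (reduce x)                   ∎
    where
    c = content x
    content≡c : content (c ⊙ f (reduce x)) ≡ c
    content≡c = begin
      content (c ⊙ f (reduce x))  ≡⟨ cong content (f-⊙ c (reduce x)) ⟨
      content (f (c ⊙ reduce x))  ≡⟨ cong (content ∘ f) (content⊙reduce x) ⟩
      content (f x)               ≡⟨ f-content x≤1 ⟩
      c                           ∎
  ... | yes c≡0 = subst (λ z → reduce (f z) ≡ f (reduce z)) origin≡x reduce-f-origin
    where
    origin≡x : (0 , 0) ≡ x
    origin≡x = trans (cong (_⊙ reduce x) (sym c≡0)) (content⊙reduce x)
    f-origin : f (0 , 0) ≡ (0 , 0)
    f-origin = f-⊙ 0 (0 , 0)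
    reduce-f-origin : reduce (f (0 , 0)) ≡ f (reduce (0 , 0))
    reduce-f-origin = trans (cong reduce f-origin) (sym f-origin)

  left-f : ∀ {x y} → AtMostOne x → AtMostOne y → left (f x) (f y) ≡ f (left x y)
  left-f {x} {y} x≤1 y≤1 = begin
    reduce (2 ⊙ f x ⊕ f y)   ≡⟨ cong (λ z → reduce (z ⊕ f y)) (f-⊙ 2 x) ⟨
    reduce (f (2 ⊙ x) ⊕ f y) ≡⟨ cong reduce (f-⊕ (⊙-AtMostOne 2 x≤1) y≤1) ⟨
    reduce (f (2 ⊙ x ⊕ y))   ≡⟨ reduce-f (⊕-AtMostOne (⊙-AtMostOne 2 x≤1) y≤1) ⟩
    f (reduce (2 ⊙ x ⊕ y))   ∎

  right-f : ∀ {x y} → AtMostOne x → AtMostOne y → right (f x) (f y) ≡ f (right x y)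
  right-f {x} {y} x≤1 y≤1 = begin
    reduce (f x ⊕ 2 ⊙ f y)   ≡⟨ cong (λ z → reduce (f x ⊕ z)) (f-⊙ 2 y) ⟨
    reduce (f x ⊕ f (2 ⊙ y)) ≡⟨ cong reduce (f-⊕ x≤1 (⊙-AtMostOne 2 y≤1)) ⟨
    reduce (f (x ⊕ 2 ⊙ y))   ≡⟨ reduce-f (⊕-AtMostOne x≤1 (⊙-AtMostOne 2 y≤1)) ⟩
    f (reduce (x ⊕ 2 ⊙ y))   ∎

  refine-map : ∀ {xs} → All AtMostOne xs → refine (map f xs) ≡ map f (refine xs)
  refine-map []                 = refl
  refine-map (_ ∷ [])           = refl
  refine-map {x ∷ _} (x≤1 ∷ y≤1 ∷ ys≤1) =
    cong₂ (λ l r → f x ∷ l ∷ r) (left-f x≤1 y≤1)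
      (cong₂ _∷_ (right-f x≤1 y≤1) (refine-map (y≤1 ∷ ys≤1)))

  refine^-map : ∀ n {xs} → All AtMostOne xs → refine^ n (map f xs) ≡ map f (refine^ n xs)
  refine^-map zero    _      = refl
  refine^-map (suc n) xs≤1 =
    trans (cong (refine^ n) (refine-map xs≤1)) (refine^-map n (refine-AtMostOne xs≤1))

  dets-map : ∀ {xs} → All AtMostOne xs → dets (map f xs) ≡ dets xs
  dets-map []                 = refl
  dets-map (_ ∷ [])           = refl
  dets-map (x≤1 ∷ y≤1 ∷ ys≤1) = cong₂ _∷_ (f-det x≤1 y≤1) (dets-map (y≤1 ∷ ys≤1))

  Cfrom-f : ∀ n {a b} → AtMostOne a → AtMostOne b → Cfrom n (f a) (f b) ≡ Cfrom n a b
  Cfrom-f n a≤1 b≤1 = trans (cong dets (refine^-map n ab≤1)) (dets-map (refine^-AtMostOne n ab≤1))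
    where ab≤1 = a≤1 ∷ b≤1 ∷ []

det-⊖ : ∀ p q r s → det (p , q) (r , s) ≡ q * r ⊖ p * s
det-⊖ p q r s = begin
  + q *ℤ + r -ℤ + p *ℤ + s   ≡⟨ cong₂ _-ℤ_ (ℤ.pos-* q r) (ℤ.pos-* p s) ⟨
  + (q * r) -ℤ + (p * s)     ≡⟨ ℤ.[+m]-[+n]≡m⊖n (q * r) (p * s) ⟩
  q * r ⊖ p * s              ∎

m+p≡o+n⇒m⊖n≡o⊖p : ∀ m n o p → m + p ≡ o + n → m ⊖ n ≡ o ⊖ p
m+p≡o+n⇒m⊖n≡o⊖p m n o p m+p≡o+n = begin
  m ⊖ n             ≡⟨ ℤ.+-cancelˡ-⊖ p m n ⟨
  (p + m) ⊖ (p + n) ≡⟨ cong₂ _⊖_ (trans (+-comm p m) (trans m+p≡o+n (+-comm o n))) (+-comm p n) ⟩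
  (n + o) ⊖ (n + p) ≡⟨ ℤ.+-cancelˡ-⊖ n o p ⟩
  o ⊖ p             ∎

det-cross : ∀ p′ q′ r′ s′ p q r s → q′ * r′ + p * s ≡ q * r + p′ * s′ →
            det (p′ , q′) (r′ , s′) ≡ det (p , q) (r , s)
det-cross p′ q′ r′ s′ p q r s e =
  trans (det-⊖ p′ q′ r′ s′) (trans (m+p≡o+n⇒m⊖n≡o⊖p (q′ * r′) (p′ * s′) (q * r) (p * s) e) (sym (det-⊖ p q r s)))

gcd[m,m+n]≡gcd[m,n] : ∀ m n → gcd m (m + n) ≡ gcd m n
gcd[m,m+n]≡gcd[m,n] m n = GCD.unique (gcd-GCD m (m + n)) (GCD.step (gcd-GCD m n))

firstThird : Frac → Frac
firstThird (p , q) = p , 2 * p + q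

firstThird-⊙ : ∀ g x → firstThird (g ⊙ x) ≡ g ⊙ firstThird x
firstThird-⊙ g (p , q) = cong (g * p ,_) (lemma g p q)
  where
  lemma : ∀ g p q → 2 * (g * p) + g * q ≡ g * (2 * p + q)
  lemma = solve-∀

firstThird-⊕ : ∀ x y → firstThird (x ⊕ y) ≡ firstThird x ⊕ firstThird y
firstThird-⊕ (p , q) (r , s) = cong (p + r ,_) (lemma p q r s)
  where
  lemma : ∀ p q r s → 2 * (p + r) + (q + s) ≡ 2 * p + q + (2 * r + s)
  lemma = solve-∀

firstThird-content : ∀ x → content (firstThird x) ≡ content x
firstThird-content (p , q) = begin
  gcd p (2 * p + q)     ≡⟨ cong (gcd p) (lemma p q) ⟩
  gcd p (p + (p + q))   ≡⟨ gcd[m,m+n]≡gcd[m,n] p (p + q) ⟩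
  gcd p (p + q)         ≡⟨ gcd[m,m+n]≡gcd[m,n] p q ⟩
  gcd p q               ∎
  where
  lemma : ∀ p q → 2 * p + q ≡ p + (p + q)
  lemma = solve-∀

firstThird-det : ∀ x y → det (firstThird x) (firstThird y) ≡ det x y
firstThird-det (p , q) (r , s) = det-cross p (2 * p + q) r (2 * r + s) p q r s (lemma p q r s)
  where
  lemma : ∀ p q r s → (2 * p + q) * r + p * s ≡ q * r + p * (2 * r + s)
  lemma = solve-∀

lastThird : Frac → Frac
lastThird (p , q) = 2 * q ∸ p , 3 * q ∸ 2 * p

k≡m+n⇒k∸m≡n : ∀ {k} m {n} → k ≡ m + n → k ∸ m ≡ n
k≡m+n⇒k∸m≡n m {n} k≡m+n = trans (cong (_∸ m) k≡m+n) (m+n∸m≡n m n)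

-- Every fraction p/q with p ≤ q is p/(p + d); in these coordinates lastThird has no truncation.
lastThird-shift : ∀ p d → lastThird (p , p + d) ≡ (p + 2 * d , p + 2 * d + d)
lastThird-shift p d = cong₂ _,_ (k≡m+n⇒k∸m≡n p (lemma₁ p d)) (k≡m+n⇒k∸m≡n (2 * p) (lemma₂ p d))
  where
  lemma₁ : ∀ p d → 2 * (p + d) ≡ p + (p + 2 * d)
  lemma₁ = solve-∀
  lemma₂ : ∀ p d → 3 * (p + d) ≡ 2 * p + (p + 2 * d + d)
  lemma₂ = solve-∀

lastThird-⊙ : ∀ g x → lastThird (g ⊙ x) ≡ g ⊙ lastThird x
lastThird-⊙ g (p , q) = cong₂ _,_
  (scale-∸ (lemma 2 g q) refl) (scale-∸ (lemma 3 g q) (lemma 2 g p))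
  where
  lemma : ∀ k g q → k * (g * q) ≡ g * (k * q)
  lemma = solve-∀
  scale-∸ : ∀ {m n m′ n′} → m′ ≡ g * m → n′ ≡ g * n → m′ ∸ n′ ≡ g * (m ∸ n)
  scale-∸ {m} {n} e₁ e₂ = trans (cong₂ _∸_ e₁ e₂) (sym (*-distribˡ-∸ g m n))

lastThird-⊕ : ∀ {x y} → AtMostOne x → AtMostOne y → lastThird (x ⊕ y) ≡ lastThird x ⊕ lastThird y
lastThird-⊕ {p , _} {r , _} p≤q r≤s with m≤n⇒∃[o]m+o≡n p≤q | m≤n⇒∃[o]m+o≡n r≤s
... | d , refl | e , refl = begin
  lastThird (p + r , p + d + (r + e))
    ≡⟨ cong (λ t → lastThird (p + r , t)) (lemma₁ p d r e) ⟩
  lastThird (p + r , p + r + (d + e))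
    ≡⟨ lastThird-shift (p + r) (d + e) ⟩
  (p + r + 2 * (d + e) , p + r + 2 * (d + e) + (d + e))
    ≡⟨ cong₂ _,_ (lemma₂ p d r e) (lemma₃ p d r e) ⟩
  (p + 2 * d , p + 2 * d + d) ⊕ (r + 2 * e , r + 2 * e + e)
    ≡⟨ cong₂ _⊕_ (lastThird-shift p d) (lastThird-shift r e) ⟨
  lastThird (p , p + d) ⊕ lastThird (r , r + e)
    ∎
  where
  lemma₁ : ∀ p d r e → p + d + (r + e) ≡ p + r + (d + e)
  lemma₁ = solve-∀
  lemma₂ : ∀ p d r e → p + r + 2 * (d + e) ≡ p + 2 * d + (r + 2 * e)
  lemma₂ = solve-∀
  lemma₃ : ∀ p d r e → p + r + 2 * (d + e) + (d + e) ≡ p + 2 * d + d + (r + 2 * e + e)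
  lemma₃ = solve-∀

lastThird-content : ∀ {x} → AtMostOne x → content (lastThird x) ≡ content x
lastThird-content {p , _} p≤q with m≤n⇒∃[o]m+o≡n p≤q
... | d , refl = begin
  content (lastThird (p , p + d)) ≡⟨ cong content (lastThird-shift p d) ⟩
  gcd (p + 2 * d) (p + 2 * d + d) ≡⟨ gcd[m,m+n]≡gcd[m,n] (p + 2 * d) d ⟩
  gcd (p + 2 * d) d               ≡⟨ gcd-comm (p + 2 * d) d ⟩
  gcd d (p + 2 * d)               ≡⟨ cong (gcd d) (lemma p d) ⟩
  gcd d (d + (d + p))             ≡⟨ gcd[m,m+n]≡gcd[m,n] d (d + p) ⟩
  gcd d (d + p)                   ≡⟨ gcd[m,m+n]≡gcd[m,n] d p ⟩
  gcd d p                         ≡⟨ gcd-comm d p ⟩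
  gcd p d                         ≡⟨ gcd[m,m+n]≡gcd[m,n] p d ⟨
  gcd p (p + d)                   ∎
  where
  lemma : ∀ p d → p + 2 * d ≡ d + (d + p)
  lemma = solve-∀

lastThird-det : ∀ {x y} → AtMostOne x → AtMostOne y → det (lastThird x) (lastThird y) ≡ det x y
lastThird-det {p , _} {r , _} p≤q r≤s with m≤n⇒∃[o]m+o≡n p≤q | m≤n⇒∃[o]m+o≡n r≤s
... | d , refl | e , refl = begin
  det (lastThird (p , p + d)) (lastThird (r , r + e))
    ≡⟨ cong₂ det (lastThird-shift p d) (lastThird-shift r e) ⟩
  det (p + 2 * d , p + 2 * d + d) (r + 2 * e , r + 2 * e + e)
    ≡⟨ det-cross (p + 2 * d) (p + 2 * d + d) (r + 2 * e) (r + 2 * e + e) p (p + d) r (r + e) (lemma p d r e) ⟩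
  det (p , p + d) (r , r + e)
    ∎
  where
  lemma : ∀ p d r e → (p + 2 * d + d) * (r + 2 * e) + p * (r + e) ≡ (p + d) * r + (p + 2 * d) * (r + 2 * e + e)
  lemma = solve-∀

module FirstThird = Equivariance firstThird firstThird-⊙
  (λ {x} {y} _ _ → firstThird-⊕ x y) (λ {x} _ → firstThird-content x) (λ {x} {y} _ _ → firstThird-det x y)
module LastThird = Equivariance lastThird lastThird-⊙ lastThird-⊕ lastThird-content lastThird-det

C-suc : ∀ n → C (suc n) ≡ C n ++ Cfrom n (1 , 3) (2 , 3) ++ C n
C-suc n = begin
  C (suc n)
    ≡⟨ C≡Cfrom (suc n) ⟩
  Cfrom (suc n) (0 , 1) (1 , 1)
    ≡⟨ Cfrom-suc n (0 , 1) (1 , 1) ⟩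
  Cfrom n (0 , 1) (1 , 3) ++ Cfrom n (1 , 3) (2 , 3) ++ Cfrom n (2 , 3) (1 , 1)
    -- firstThird sends (0 , 1), (1 , 1) to (0 , 1), (1 , 3); lastThird sends them to (2 , 3), (1 , 1).
    ≡⟨ cong₂ (λ xs zs → xs ++ Cfrom n (1 , 3) (2 , 3) ++ zs)
             (FirstThird.Cfrom-f n 0≤1 1≤1) (LastThird.Cfrom-f n 0≤1 1≤1) ⟩
  Cfrom n (0 , 1) (1 , 1) ++ Cfrom n (1 , 3) (2 , 3) ++ Cfrom n (0 , 1) (1 , 1)
    ≡⟨ cong₂ (λ xs zs → xs ++ Cfrom n (1 , 3) (2 , 3) ++ zs) (C≡Cfrom n) (C≡Cfrom n) ⟨
  C n ++ Cfrom n (1 , 3) (2 , 3) ++ C n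
    ∎
  where
  0≤1 : AtMostOne (0 , 1)
  0≤1 = z≤n
  1≤1 : AtMostOne (1 , 1)
  1≤1 = s≤s z≤n

corollary17 : (n k : ℕ) → k < 3 ^ n →
    (at (C (suc n)) k ≡ at (C n) k) × (at (C (suc n)) (2 * 3 ^ n + k) ≡ at (C n) k)
corollary17 n k k<3ⁿ = firstCopy , lastCopy
  where
  M = Cfrom n (1 , 3) (2 , 3)
  length-C : length (C n) ≡ 3 ^ n
  length-C = trans (cong length (C≡Cfrom n)) (length-Cfrom n _ _)
  firstCopy : at (C (suc n)) k ≡ at (C n) k
  firstCopy = begin
    at (C (suc n)) k         ≡⟨ cong (λ xs → at xs k) (C-suc n) ⟩
    at (C n ++ M ++ C n) k   ≡⟨ at-++ˡ (C n) (subst (k <_) (sym length-C) k<3ⁿ) ⟩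
    at (C n) k               ∎
  index : 2 * 3 ^ n + k ≡ length (C n) + (length M + k)
  index rewrite length-C | length-Cfrom n (1 , 3) (2 , 3) = lemma (3 ^ n) k
    where
    lemma : ∀ m k → 2 * m + k ≡ m + (m + k)
    lemma = solve-∀
  lastCopy : at (C (suc n)) (2 * 3 ^ n + k) ≡ at (C n) k
  lastCopy = begin
    at (C (suc n)) (2 * 3 ^ n + k)                          ≡⟨ cong₂ at (C-suc n) index ⟩
    at (C n ++ M ++ C n) (length (C n) + (length M + k))   ≡⟨ at-++ʳ (C n) ⟩
    at (M ++ C n) (length M + k)                            ≡⟨ at-++ʳ M ⟩
    at (C n) k                                              ∎
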